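{- Let $G$ be a minimal non-$\mathcal{L}$-colourable graph with respect to some $k$-list-assignment $\mathcal{L} = \{L(v) : v \in V(G)\}$. Then: (a) $G$ is connected; (b) for every colour $\alpha \in L(V(G))$ there are two distinct vertices $x, y \in V(G)$ such that $\alpha \in L(x) \cap L(y)$; (c) there exist some $j \geq k$ and sets $Y \subseteq L(V(G))$ of size $j$ and $X \subseteq V(G)$ of size $j+1$ such that $L(X) \subseteq Y$.
   Context: A $k$-list-assignment for $G$ is a family $\mathcal{L}=\{L(v): v\in V(G)\}$ of sets with $|L(v)|=k$ for all $v$. $G$ is $\mathcal{L}$-colourable if there is a proper colouring $c$ of $G$ with $c(v) \in L(v)$ for all $v$. For $U \subseteq V(G)$, $L(U) = \bigcup_{v \in U} L(v)$ and $\mathcal{L}|_U = \{L(v): v\in U\}$. $G$ is minimal non-$\mathcal{L}$-colourable if $G$ is not $\mathcal{L}$-colourable but $G \setminus v$ is $\mathcal{L}|_{V(G)\setminus\{v\}}$-colourable for every $v \in V(G)$. -}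

module Defs where

open import Data.Nat using (ℕ; suc; _≤_)
open import Data.Fin using (Fin)
open import Data.Bool using (Bool; true; false)
open import Data.List using (List; length)
open import Data.List.Membership.Propositional using (_∈_)
open import Data.List.Relation.Unary.Unique.Propositional using (Unique)
open import Data.Unit using (⊤)
open import Data.Product using (Σ; ∃; _×_)
open import Relation.Binary.PropositionalEquality using (_≡_; _≢_)
open import Relation.Nullary using (¬_)

record Graph (n : ℕ) : Set where
  field
    adj     : Fin n → Fin n → Bool
    adj-sym : ∀ u v → adj u v ≡ adj v u
    irrefl  : ∀ v → adj v v ≡ false

open Graph public

ListAssignment : ℕ → Set
ListAssignment n = Fin n → List ℕ

IsKListAssignment : ∀ {n} → ℕ → ListAssignment n → Set
IsKListAssignment k L = ∀ v → Unique (L v) × length (L v) ≡ k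

-- G[U] is 𝓛|_U-colourable, where U ⊆ V(G) is given by a predicate.
ColourableOn : ∀ {n} → Graph n → ListAssignment n → (Fin n → Set) → Set
ColourableOn {n} G L U =
  Σ (Fin n → ℕ) λ c →
      (∀ v → U v → c v ∈ L v)
    × (∀ u v → U u → U v → adj G u v ≡ true → c u ≢ c v)

Colourable : ∀ {n} → Graph n → ListAssignment n → Set
Colourable G L = ColourableOn G L (λ _ → ⊤)

ColourableWithout : ∀ {n} → Graph n → ListAssignment n → Fin n → Set
ColourableWithout G L v = ColourableOn G L (λ u → u ≢ v)

MinimalNonColourable : ∀ {n} → Graph n → ListAssignment n → Set
MinimalNonColourable G L = ¬ Colourable G L × (∀ v → ColourableWithout G L v)

data Walk {n} (G : Graph n) : Fin n → Fin n → Set where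
  here : ∀ {u} → Walk G u u
  step : ∀ {u v w} → adj G u v ≡ true → Walk G v w → Walk G u w

Connected : ∀ {n} → Graph n → Set
Connected G = ∀ u v → Walk G u v

InLV : ∀ {n} → ListAssignment n → ℕ → Set
InLV L α = ∃ λ v → α ∈ L v

-- (a) If some v were not reachable from u, the set R of vertices reachable from u would be
-- closed under adjacency, so a colouring of G ∖ v used on R and a colouring of G ∖ u used
-- off R would together colour G.
-- (b) A colour α lying in L(v) only can be given to v in a colouring of G ∖ v.
-- (c) Distinct representatives of the lists form a proper colouring, so by Hall's theorem
-- some set X of vertices has |L(X)| < |X|; then j = |L(X)| ≥ k, and any j + 1 vertices of X
-- will do.
-- Hall's theorem is proved constructively by induction on the number of vertices: give the
-- first vertex u a colour a ∈ L(u) and delete a from the other lists. If the other vertices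
-- then have a deficient set Z, Z is tight for the original lists (|L(Z)| ≤ |Z|), and one
-- recurses separately on Z and, with the colours of L(Z) deleted, on the vertices outside Z.
{-# OPTIONS --safe #-}
module Submission where

open import Defs
open import Data.Bool using (true) renaming (_≟_ to _≟ᵇ_)
open import Data.Fin using (Fin)
open import Data.Fin.Properties using (any?) renaming (_≟_ to _≟ᶠ_)
open import Data.List using (List; []; _∷_; [_]; _++_; length; filter; take; allFin; concatMap; deduplicate)
open import Data.List.Properties using (length-++; length-take; length-tabulate; filter-notAll; length-removeAt′)
open import Data.List.Membership.Propositional using (_∈_; _∉_; lose; find)
open import Data.List.Membership.Propositional.Properties
  using (∈-++⁺ˡ; ∈-++⁺ʳ; ∈-++⁻; ∈-filter⁺; ∈-filter⁻; ∈-allFin; ∈-concatMap⁺; ∈-concatMap⁻; ∈-deduplicate⁺; ∈-deduplicate⁻)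
open import Data.List.Relation.Binary.Subset.Propositional using (_⊆_)
import Data.List.Relation.Binary.Sublist.Propositional.Properties as Sublist
open import Data.List.Relation.Unary.All using ([])
open import Data.List.Relation.Unary.All.Properties using (¬Any⇒All¬; All¬⇒¬Any)
open import Data.List.Relation.Unary.Any using (here; there; _─_)
open import Data.List.Relation.Unary.Unique.Propositional using (Unique; []; _∷_)
open import Data.List.Relation.Unary.Unique.Propositional.Properties using (++⁺; take⁺)
open import Data.Nat using (ℕ; suc; _≤_; _<_; _+_; z≤n; s≤s)
open import Data.Nat.Properties
  using (≤-refl; ≤-trans; ≤-<-trans; <-irrefl; ≤-pred; +-suc; +-mono-≤-<; m≤m+n; m≤n⇒m⊓n≡m; module ≤-Reasoning)
  renaming (_≟_ to _≟ⁿ_)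
open import Data.List.Membership.DecPropositional _≟ⁿ_ using () renaming (_∈?_ to _∈ⁿ?_; _∉?_ to _∉ⁿ?_)
open import Data.List.Relation.Unary.Unique.DecPropositional.Properties _≟ⁿ_ using (deduplicate-!)
open import Data.Product using (Σ; ∃; _×_; _,_; proj₁; proj₂)
open import Data.Sum using (_⊎_; inj₁; inj₂; [_,_]′)
open import Data.Unit using (⊤)
open import Function using (_∘_; id)
open import Relation.Binary.Definitions using (DecidableEquality) renaming (Decidable to Decidable₂)
open import Relation.Binary.PropositionalEquality using (_≡_; _≢_; refl; sym; trans; subst)
open import Relation.Nullary using (¬_; yes; no; ¬?; contradiction)
open import Relation.Nullary.Decidable using (_×-dec_)
open import Relation.Unary using (Decidable; ∁)

∈-─⁺ : ∀ {A : Set} {x z : A} {ys} (x∈ys : x ∈ ys) → z ∈ ys → z ≢ x → z ∈ (ys ─ x∈ys)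
∈-─⁺ (here refl)  (here refl)  z≢x = contradiction refl z≢x
∈-─⁺ (here refl)  (there z∈ys) _   = z∈ys
∈-─⁺ (there _)    (here refl)  _   = here refl
∈-─⁺ (there x∈ys) (there z∈ys) z≢x = there (∈-─⁺ x∈ys z∈ys z≢x)

Unique-⊆⇒length≤ : ∀ {A : Set} {xs ys : List A} → Unique xs → xs ⊆ ys → length xs ≤ length ys
Unique-⊆⇒length≤ {xs = []} _ _ = z≤n
Unique-⊆⇒length≤ {xs = x ∷ xs} {ys} (x∉xs ∷ uxs) x∷xs⊆ys =
  subst (suc (length xs) ≤_) (sym (length-removeAt′ ys _))
    (s≤s (Unique-⊆⇒length≤ uxs λ z∈xs → ∈-─⁺ x∈ys (x∷xs⊆ys (there z∈xs)) (z≢x z∈xs)))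
  where
    x∈ys : x ∈ ys
    x∈ys = x∷xs⊆ys (here refl)

    z≢x : ∀ {z} → z ∈ xs → z ≢ x
    z≢x z∈xs refl = All¬⇒¬Any x∉xs z∈xs

colours : {A : Set} → (A → List ℕ) → List A → List ℕ
colours L X = deduplicate _≟ⁿ_ (concatMap L X)

module _ {A : Set} (L : A → List ℕ) where

  colours-unique : ∀ X → Unique (colours L X)
  colours-unique X = deduplicate-! (concatMap L X)

  ∈-colours⁺ : ∀ {X x} → x ∈ X → L x ⊆ colours L X
  ∈-colours⁺ x∈X α∈Lx = ∈-deduplicate⁺ _≟ⁿ_ (∈-concatMap⁺ L (lose x∈X α∈Lx))

  ∈-colours⁻ : ∀ X {α} → α ∈ colours L X → ∃ λ x → x ∈ X × α ∈ L x
  ∈-colours⁻ X = find ∘ ∈-concatMap⁻ L ∘ ∈-deduplicate⁻ _≟ⁿ_ (concatMap L X)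

  colours-least : ∀ {X Y} → (∀ {x} → x ∈ X → L x ⊆ Y) → colours L X ⊆ Y
  colours-least {X} L⊆Y α∈ with x , x∈X , α∈Lx ← ∈-colours⁻ X α∈ = L⊆Y x∈X α∈Lx

module Hall {I : Set} (_≟_ : DecidableEquality I) where
  open import Data.List.Membership.DecPropositional _≟_ using (_∈?_; _∉?_)

  Covers : (I → List ℕ) → List I → List ℕ → Set
  Covers L X Y = ∀ {x} → x ∈ X → L x ⊆ Y

  record DistinctRepresentatives (L : I → List ℕ) (vs : List I) : Set where
    constructor representatives
    field
      choice    : I → ℕ
      choice∈   : ∀ {v} → v ∈ vs → choice v ∈ L v
      injective : ∀ {u v} → u ∈ vs → v ∈ vs → choice u ≡ choice v → u ≡ v

  record Deficient (L : I → List ℕ) (vs : List I) : Set where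
    constructor deficient
    field
      X      : List I
      unique : Unique X
      X⊆vs   : X ⊆ vs
      Y      : List ℕ
      short  : length Y < length X
      covers : Covers L X Y

  RepresentedOrDeficient : (I → List ℕ) → List I → Set
  RepresentedOrDeficient L vs = DistinctRepresentatives L vs ⊎ Deficient L vs

  _without_ : (I → List ℕ) → List ℕ → I → List ℕ
  (L without Y) v = filter (_∉ⁿ? Y) (L v)

  _∖_ : List I → List I → List I
  vs ∖ Z = filter (_∉? Z) vs

  ∈-without⁻ : ∀ {L Y v α} → α ∈ (L without Y) v → α ∈ L v × α ∉ Y
  ∈-without⁻ = ∈-filter⁻ (_∉ⁿ? _)

  ∈-∖⁺ : ∀ {vs Z v} → v ∈ vs → v ∉ Z → v ∈ vs ∖ Z
  ∈-∖⁺ = ∈-filter⁺ (_∉? _)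

  ∈-∖⁻ : ∀ {vs Z v} → v ∈ vs ∖ Z → v ∈ vs × v ∉ Z
  ∈-∖⁻ = ∈-filter⁻ (_∉? _)

  length-∖< : ∀ {vs Z z} → z ∈ Z → z ∈ vs → length (vs ∖ Z) < length vs
  length-∖< z∈Z z∈vs = filter-notAll (_∉? _) _ (lose z∈vs (λ z∉Z → z∉Z z∈Z))

  covers-without : ∀ {L X Y Y′} → Covers (L without Y) X Y′ → Covers L X (Y ++ Y′)
  covers-without {Y = Y} cov x∈X {α} α∈Lx with α ∈ⁿ? Y
  ... | yes α∈Y = ∈-++⁺ˡ α∈Y
  ... | no  α∉Y = ∈-++⁺ʳ Y (cov x∈X (∈-filter⁺ (_∉ⁿ? Y) α∈Lx α∉Y))

  representatives-mono : ∀ {L vs ws} → ws ⊆ vs → DistinctRepresentatives L vs → DistinctRepresentatives L ws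
  representatives-mono ws⊆vs (representatives c c∈ c-inj) =
    representatives c (c∈ ∘ ws⊆vs) (λ u∈ws v∈ws → c-inj (ws⊆vs u∈ws) (ws⊆vs v∈ws))

  deficient-mono : ∀ {L vs ws} → vs ⊆ ws → Deficient L vs → Deficient L ws
  deficient-mono vs⊆ws (deficient X uX X⊆vs Y short cov) = deficient X uX (vs⊆ws ∘ X⊆vs) Y short cov

  representatives-join : ∀ {L vs Z Y} (r : DistinctRepresentatives L Z)
    → (∀ {v} → v ∈ Z → DistinctRepresentatives.choice r v ∈ Y)
    → DistinctRepresentatives (L without Y) (vs ∖ Z) → DistinctRepresentatives L vs
  representatives-join {L} {vs} {Z} {Y} (representatives c₁ c₁∈ c₁-inj) c₁∈Y (representatives c₂ c₂∈ c₂-inj) =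
    representatives c c∈ c-inj
    where
      c : I → ℕ
      c v with v ∈? Z
      ... | yes _ = c₁ v
      ... | no  _ = c₂ v

      c₂∉Y : ∀ {v} → v ∈ vs → v ∉ Z → c₂ v ∉ Y
      c₂∉Y v∈vs v∉Z = proj₂ (∈-without⁻ {L} (c₂∈ (∈-∖⁺ v∈vs v∉Z)))

      c∈ : ∀ {v} → v ∈ vs → c v ∈ L v
      c∈ {v} v∈vs with v ∈? Z
      ... | yes v∈Z = c₁∈ v∈Z
      ... | no  v∉Z = proj₁ (∈-without⁻ {L} (c₂∈ (∈-∖⁺ v∈vs v∉Z)))

      c-inj : ∀ {u v} → u ∈ vs → v ∈ vs → c u ≡ c v → u ≡ v
      c-inj {u} {v} u∈vs v∈vs with u ∈? Z | v ∈? Z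
      ... | yes u∈Z | yes v∈Z = c₁-inj u∈Z v∈Z
      ... | yes u∈Z | no  v∉Z = λ eq → contradiction (subst (_∈ Y) eq (c₁∈Y u∈Z)) (c₂∉Y v∈vs v∉Z)
      ... | no  u∉Z | yes v∈Z = λ eq → contradiction (subst (_∈ Y) (sym eq) (c₁∈Y v∈Z)) (c₂∉Y u∈vs u∉Z)
      ... | no  u∉Z | no  v∉Z = c₂-inj (∈-∖⁺ u∈vs u∉Z) (∈-∖⁺ v∈vs v∉Z)

  representatives-∷ : ∀ {L u vs a} → a ∈ L u → DistinctRepresentatives (L without [ a ]) vs
    → DistinctRepresentatives L (u ∷ vs)
  representatives-∷ {L} {u} {vs} {a} a∈Lu r =
    representatives-join {Z = [ u ]} single (λ { (here refl) → here refl }) (representatives-mono rest⊆vs r)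
    where
      single : DistinctRepresentatives L [ u ]
      single = representatives (λ _ → a) (λ { (here refl) → a∈Lu }) (λ { (here refl) (here refl) _ → refl })

      rest⊆vs : (u ∷ vs) ∖ [ u ] ⊆ vs
      rest⊆vs v∈ with ∈-∖⁻ {u ∷ vs} {[ u ]} v∈
      ... | here refl , v∉[u] = contradiction (here refl) v∉[u]
      ... | there v∈vs , _   = v∈vs

  deficient-join : ∀ {L vs Z Y} → Unique Z → Z ⊆ vs → Covers L Z Y → length Y ≤ length Z
    → Deficient (L without Y) (vs ∖ Z) → Deficient L vs
  deficient-join {L} {vs} {Z} {Y} uZ Z⊆vs covZ |Y|≤|Z| (deficient X uX X⊆ Y′ |Y′|<|X|  covX) =
    deficient (Z ++ X) (++⁺ uZ uX disjoint) Z++X⊆vs (Y ++ Y′) shorter covers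
    where
      disjoint : ∀ {v} → ¬ (v ∈ Z × v ∈ X)
      disjoint (v∈Z , v∈X) = proj₂ (∈-∖⁻ {vs} (X⊆ v∈X)) v∈Z

      Z++X⊆vs : Z ++ X ⊆ vs
      Z++X⊆vs = [ Z⊆vs , proj₁ ∘ ∈-∖⁻ {vs} ∘ X⊆ ]′ ∘ ∈-++⁻ Z

      shorter : length (Y ++ Y′) < length (Z ++ X)
      shorter = begin-strict
        length (Y ++ Y′)      ≡⟨ length-++ Y ⟩
        length Y + length Y′  <⟨ +-mono-≤-< |Y|≤|Z| |Y′|<|X| ⟩
        length Z + length X   ≡⟨ length-++ Z ⟨
        length (Z ++ X)       ∎
        where open ≤-Reasoning

      covers : Covers L (Z ++ X) (Y ++ Y′)
      covers v∈Z++X with ∈-++⁻ Z v∈Z++X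
      ... | inj₁ v∈Z = ∈-++⁺ˡ ∘ covZ v∈Z
      ... | inj₂ v∈X = covers-without {L} covX v∈X

  split-at-tight : ∀ {L vs Z Y} → Unique Z → Z ⊆ vs → Covers L Z Y → length Y ≤ length Z
    → RepresentedOrDeficient L Z → RepresentedOrDeficient (L without Y) (vs ∖ Z) → RepresentedOrDeficient L vs
  split-at-tight _  Z⊆vs _    _       (inj₂ d) _         = inj₂ (deficient-mono Z⊆vs d)
  split-at-tight _  _    covZ _       (inj₁ r) (inj₁ r′) =
    inj₁ (representatives-join r (λ v∈Z → covZ v∈Z (DistinctRepresentatives.choice∈ r v∈Z)) r′)
  split-at-tight uZ Z⊆vs covZ |Y|≤|Z| (inj₁ _) (inj₂ d)  = inj₂ (deficient-join uZ Z⊆vs covZ |Y|≤|Z| d)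

  hall-≤ : ∀ m L vs → length vs ≤ m → RepresentedOrDeficient L vs
  hall-≤ _       L []         _ = inj₁ (representatives (λ _ → 0) (λ ()) (λ ()))
  hall-≤ (suc m) L (u ∷ rest) (s≤s |rest|≤m) with L u in Lu≡
  ... | []    = inj₂ (deficient [ u ] ([] ∷ []) (λ { (here refl) → here refl }) [] (s≤s z≤n)
                  λ { (here refl) α∈Lu → contradiction (subst (_ ∈_) Lu≡ α∈Lu) λ () })
  ... | a ∷ _ with hall-≤ m (L without [ a ]) rest |rest|≤m
  ...   | inj₁ r = inj₁ (representatives-∷ (subst (a ∈_) (sym Lu≡) (here refl)) r)
  ...   | inj₂ (deficient [] _ _ _ () _)
  ...   | inj₂ (deficient Z@(_ ∷ _) uZ Z⊆rest Y |Y|<|Z| covZ) =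
    split-at-tight uZ (there ∘ Z⊆rest) (covers-without {L} {Y = [ a ]} covZ) |Y|<|Z|
      (hall-≤ m L Z (≤-trans (Unique-⊆⇒length≤ uZ Z⊆rest) |rest|≤m))
      (hall-≤ m (L without (a ∷ Y)) ((u ∷ rest) ∖ Z) (≤-trans (≤-pred |vs∖Z|<|vs|) |rest|≤m))
    where
      |vs∖Z|<|vs| : length ((u ∷ rest) ∖ Z) < length (u ∷ rest)
      |vs∖Z|<|vs| = length-∖< (here refl) (there (Z⊆rest (here refl)))

  hall : ∀ L vs → RepresentedOrDeficient L vs
  hall L vs = hall-≤ (length vs) L vs ≤-refl


module _ {n : ℕ} where
  open import Data.List.Membership.DecPropositional (_≟ᶠ_ {n}) using (_∈?_; _∉?_)
  open Hall (_≟ᶠ_ {n})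

  Unique⇒complete : ∀ {R} → Unique R → n ≤ length R → ∀ w → w ∈ R
  Unique⇒complete {R} uR n≤|R| w with w ∈? R
  ... | yes w∈R = w∈R
  ... | no  w∉R = contradiction (≤-trans (s≤s n≤|R|) |w∷R|≤n) (<-irrefl refl)
    where
      |w∷R|≤n : suc (length R) ≤ n
      |w∷R|≤n = subst (suc (length R) ≤_) (length-tabulate id)
        (Unique-⊆⇒length≤ (¬Any⇒All¬ R w∉R ∷ uR) (λ {v} _ → ∈-allFin v))

  module _ (E : Fin n → Fin n → Set) (E? : Decidable₂ E) where

    Closed : List (Fin n) → Set
    Closed R = ∀ {w w′} → E w w′ → w ∈ R → w′ ∈ R

    module _ (P : Fin n → Set) (P-closed : ∀ {w w′} → E w w′ → P w → P w′) where

      closure-grow : ∀ fuel R → Unique R → n ≤ fuel + length R → (∀ {w} → w ∈ R → P w)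
        → ∃ λ R′ → R ⊆ R′ × Closed R′ × (∀ {w} → w ∈ R′ → P w)
      closure-grow 0 R uR n≤|R| R⊆P = R , id , (λ {_} {w′} _ _ → Unique⇒complete uR n≤|R| w′) , R⊆P
      closure-grow (suc fuel) R uR n≤ R⊆P
        with any? (λ w → (w ∈? R) ×-dec any? (λ w′ → (w′ ∉? R) ×-dec E? w w′))
      ... | yes (w , w∈R , w′ , w′∉R , e)
        with R′ , R⊆R′ , closed , R′⊆P ← closure-grow fuel (w′ ∷ R) (¬Any⇒All¬ R w′∉R ∷ uR)
               (subst (n ≤_) (sym (+-suc fuel (length R))) n≤)
               (λ { (here refl) → P-closed e (R⊆P w∈R) ; (there v∈R) → R⊆P v∈R })
        = R′ , R⊆R′ ∘ there , closed , R′⊆P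
      ... | no no-exit = R , id , closed , R⊆P
        where
          closed : Closed R
          closed {w} {w′} e w∈R with w′ ∈? R
          ... | yes w′∈R = w′∈R
          ... | no  w′∉R = contradiction (w , w∈R , w′ , w′∉R , e) no-exit

      closure-within : ∀ {u} → P u → ∃ λ R → u ∈ R × Closed R × (∀ {w} → w ∈ R → P w)
      closure-within {u} Pu
        with R , [u]⊆R , closed , R⊆P ← closure-grow n [ u ] ([] ∷ []) (m≤m+n n 1) (λ { (here refl) → Pu })
        = R , [u]⊆R (here refl) , closed , R⊆P

  deficient⇒deficient-by-one : ∀ {k} {L : ListAssignment n} {vs} → IsKListAssignment k L → Deficient L vs
    → ∃ λ j → k ≤ j
        × Σ (List ℕ) λ Y → Unique Y × length Y ≡ j × (∀ α → α ∈ Y → InLV L α)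
        × Σ (List (Fin n)) λ X → Unique X × length X ≡ suc j
            × (∀ x α → x ∈ X → α ∈ L x → α ∈ Y)
  deficient⇒deficient-by-one isK (deficient [] _ _ _ () _)
  deficient⇒deficient-by-one {k} {L} isK (deficient X@(x₀ ∷ _) uX _ Y |Y|<|X| covX) =
    j , k≤j , colours L X , colours-unique L X , refl , colour-used ,
    take (suc j) X , take⁺ (suc j) uX , |X′|≡suc-j , λ _ _ x∈X′ → ∈-colours⁺ L (take⊆X x∈X′)
    where
      j : ℕ
      j = length (colours L X)

      k≤j : k ≤ j
      k≤j = subst (_≤ j) (proj₂ (isK x₀)) (Unique-⊆⇒length≤ (proj₁ (isK x₀)) (∈-colours⁺ L {X} (here refl)))

      j<|X| : j < length X
      j<|X| = ≤-<-trans (Unique-⊆⇒length≤ (colours-unique L X) (colours-least L covX)) |Y|<|X|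

      |X′|≡suc-j : length (take (suc j) X) ≡ suc j
      |X′|≡suc-j = trans (length-take (suc j) X) (m≤n⇒m⊓n≡m j<|X|)

      take⊆X : take (suc j) X ⊆ X
      take⊆X = Sublist.Any-resp-⊆ (Sublist.take-⊆ (suc j) X)

      colour-used : ∀ α → α ∈ colours L X → InLV L α
      colour-used α α∈ with x , _ , α∈Lx ← ∈-colours⁻ L X α∈ = x , α∈Lx

  module _ {G : Graph n} {L : ListAssignment n} where

    adj⇒≢ : ∀ {u v} → adj G u v ≡ true → u ≢ v
    adj⇒≢ {u} e refl with () ← trans (sym e) (irrefl G u)

    ColourableOn-mono : ∀ {P Q : Fin n → Set} → (∀ {v} → Q v → P v) → ColourableOn G L P → ColourableOn G L Q
    ColourableOn-mono Q⊆P (c , c∈ , proper) =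
      c , (λ v → c∈ v ∘ Q⊆P) , (λ u v Qu Qv → proper u v (Q⊆P Qu) (Q⊆P Qv))

    colourable-glue : (R : Fin n → Set) → Decidable R → (∀ {a b} → adj G a b ≡ true → R a → R b)
      → ColourableOn G L R → ColourableOn G L (∁ R) → Colourable G L
    colourable-glue R R? closed (c₁ , c₁∈ , proper₁) (c₂ , c₂∈ , proper₂) = c , c∈ , proper
      where
        c : Fin n → ℕ
        c v with R? v
        ... | yes _ = c₁ v
        ... | no  _ = c₂ v

        c∈ : ∀ v → ⊤ → c v ∈ L v
        c∈ v _ with R? v
        ... | yes Rv  = c₁∈ v Rv
        ... | no  ¬Rv = c₂∈ v ¬Rv

        proper : ∀ u v → ⊤ → ⊤ → adj G u v ≡ true → c u ≢ c v
        proper u v _ _ e with R? u | R? v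
        ... | yes Ru  | yes Rv  = proper₁ u v Ru Rv e
        ... | yes Ru  | no  ¬Rv = contradiction (closed e Ru) ¬Rv
        ... | no  ¬Ru | yes Rv  = contradiction (closed (trans (adj-sym G v u) e) Rv) ¬Ru
        ... | no  ¬Ru | no  ¬Rv = proper₂ u v ¬Ru ¬Rv e

    walk-snoc : ∀ {u v w} → Walk G u v → adj G v w ≡ true → Walk G u w
    walk-snoc here         e = step e here
    walk-snoc (step e′ p) e = step e′ (walk-snoc p e)

    minimal⇒connected : MinimalNonColourable G L → Connected G
    minimal⇒connected (¬colourable , colourable-without) u v
      with R , u∈R , closed , walks ← closure-within (λ a b → adj G a b ≡ true) (λ a b → adj G a b ≟ᵇ true)
                                       (Walk G u) (λ e p → walk-snoc p e) here
      with v ∈? R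
    ... | yes v∈R = walks v∈R
    ... | no  v∉R = contradiction
      (colourable-glue (_∈ R) (_∈? R) closed
        (ColourableOn-mono (λ w∈R w≡v → v∉R (subst (_∈ R) w≡v w∈R)) (colourable-without v))
        (ColourableOn-mono (λ w∉R w≡u → w∉R (subst (_∈ R) (sym w≡u) u∈R)) (colourable-without u)))
      ¬colourable

    colourable-with-private-colour : ∀ {v α} → ColourableWithout G L v → α ∈ L v
      → (∀ {x} → x ≢ v → α ∉ L x) → Colourable G L
    colourable-with-private-colour {v} {α} (c′ , c′∈ , proper′) α∈Lv α-private = c , c∈ , proper
      where
        c : Fin n → ℕ
        c w with w ≟ᶠ v
        ... | yes _ = α
        ... | no  _ = c′ w

        c∈ : ∀ w → ⊤ → c w ∈ L w
        c∈ w _ with w ≟ᶠ v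
        ... | yes refl = α∈Lv
        ... | no  w≢v  = c′∈ w w≢v

        proper : ∀ a b → ⊤ → ⊤ → adj G a b ≡ true → c a ≢ c b
        proper a b _ _ e with a ≟ᶠ v | b ≟ᶠ v
        ... | yes a≡v | yes b≡v = contradiction (trans a≡v (sym b≡v)) (adj⇒≢ e)
        ... | yes _   | no  b≢v = λ α≡cb → α-private b≢v (subst (_∈ L b) (sym α≡cb) (c′∈ b b≢v))
        ... | no  a≢v | yes _   = λ ca≡α → α-private a≢v (subst (_∈ L a) ca≡α (c′∈ a a≢v))
        ... | no  a≢v | no  b≢v = proper′ a b a≢v b≢v e

    minimal⇒colour-shared : MinimalNonColourable G L
      → ∀ α → InLV L α → ∃ λ x → ∃ λ y → x ≢ y × α ∈ L x × α ∈ L y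
    minimal⇒colour-shared (¬colourable , colourable-without) α (v , α∈Lv)
      with any? (λ x → ¬? (x ≟ᶠ v) ×-dec (α ∈ⁿ? L x))
    ... | yes (x , x≢v , α∈Lx) = v , x , x≢v ∘ sym , α∈Lv , α∈Lx
    ... | no  ¬shared = contradiction
      (colourable-with-private-colour (colourable-without v) α∈Lv (λ x≢v α∈Lx → ¬shared (_ , x≢v , α∈Lx)))
      ¬colourable

    representatives⇒colourable : DistinctRepresentatives L (allFin n) → Colourable G L
    representatives⇒colourable (representatives c c∈ c-inj) =
      c , (λ v _ → c∈ (∈-allFin v)) , (λ u v _ _ e → adj⇒≢ e ∘ c-inj (∈-allFin u) (∈-allFin v))

    non-colourable⇒deficient : ¬ Colourable G L → Deficient L (allFin n)
    non-colourable⇒deficient ¬colourable with hall L (allFin n)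
    ... | inj₁ r = contradiction (representatives⇒colourable r) ¬colourable
    ... | inj₂ d = d

claim2p2 : ∀ {n} (k : ℕ) (G : Graph n) (L : ListAssignment n)
  → IsKListAssignment k L
  → MinimalNonColourable G L
  → Connected G
    × (∀ α → InLV L α → ∃ λ x → ∃ λ y → x ≢ y × α ∈ L x × α ∈ L y)
    × (∃ λ j → k ≤ j
        × Σ (List ℕ) λ Y → Unique Y × length Y ≡ j × (∀ α → α ∈ Y → InLV L α)
        × Σ (List (Fin n)) λ X → Unique X × length X ≡ suc j
            × (∀ x α → x ∈ X → α ∈ L x → α ∈ Y))
claim2p2 k G L isK minimal@(¬colourable , _) =
  minimal⇒connected minimal ,
  minimal⇒colour-shared {G = G} minimal ,
  deficient⇒deficient-by-one isK (non-colourable⇒deficient {G = G} ¬colourable)
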